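{- Let $\lambda \vdash n$ such that each part $\lambda_{i} \geq 3$. Then \[ \mathbb{E}_{\lambda}[\operatorname{des}] = \frac{n-1}{2}. \]
   Context: For $\omega\in S_n$, a descent of $\omega$ is an index $i\in[n-1]$ with $\omega(i)>\omega(i+1)$, and $\operatorname{des}(\omega)$ denotes the number of descents of $\omega$. $C_\lambda$ denotes the conjugacy class of $S_n$ indexed by the partition $\lambda\vdash n$, and $\mathbb{E}_\lambda$ denotes expectation with respect to the uniform measure on $C_\lambda$. -}

module Defs where

open import Data.Nat using (ℕ; zero; suc; _+_; _<ᵇ_; _≤ᵇ_)
open import Data.Nat.Properties using (_≟_)
open import Data.Bool using (Bool; true; false; _∧_; not; if_then_else_)
open import Data.Fin using (Fin; toℕ)
import Data.Fin as Fin
open import Data.Vec using (Vec; []; _∷_; lookup; toList)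
open import Data.List using (List; []; _∷_; concatMap; map; filter; length; allFin)
open import Data.Bool.ListAction using (and)
open import Data.Nat.ListAction using (sum)
open import Data.List.Relation.Unary.All using (All)
open import Data.Integer using (+_)
open import Data.Rational using (ℚ; _/_)
open import Relation.Nullary.Decidable using (⌊_⌋)
open import Relation.Binary.PropositionalEquality using (_≡_)

-- A permutation of [n] (written 0-indexed as Fin n) in one-line notation:
-- the vector (ω(0), …, ω(n-1)); it is a permutation iff it is injective.

allVecs : (k n : ℕ) → List (Vec (Fin n) k)
allVecs zero    n = [] ∷ []
allVecs (suc k) n = concatMap (λ x → map (x ∷_) (allVecs k n)) (allFin n)

_==_ : {n : ℕ} → Fin n → Fin n → Bool
i == j = ⌊ toℕ i ≟ toℕ j ⌋

isPerm : {n : ℕ} → Vec (Fin n) n → Bool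
isPerm {n} ω = and (map (λ i → and (map (λ j →
  if lookup ω i == lookup ω j then i == j else true) (allFin n))) (allFin n))

Sym : (n : ℕ) → List (Vec (Fin n) n)
Sym n = filter (λ ω → isPerm ω ≡? true) (allVecs n n)
  where
  open import Data.Bool.Properties using () renaming (_≟_ to _≡?_)

iter : {n : ℕ} → Vec (Fin n) n → ℕ → Fin n → Fin n
iter ω zero    i = i
iter ω (suc k) i = lookup ω (iter ω k i)

-- length of the cycle of ω containing i: least k ∈ {1,…,n} with ω^k(i) = i
cycleLenFrom : {n : ℕ} → Vec (Fin n) n → Fin n → ℕ → ℕ → ℕ
cycleLenFrom ω i k zero    = k
cycleLenFrom ω i k (suc fuel) =
  if iter ω k i == i then k else cycleLenFrom ω i (suc k) fuel

cycleLen : {n : ℕ} → Vec (Fin n) n → Fin n → ℕ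
cycleLen {n} ω i = cycleLenFrom ω i 1 n

isCycleMin : {n : ℕ} → Vec (Fin n) n → Fin n → Bool
isCycleMin {n} ω i = and (map (λ k → toℕ i ≤ᵇ toℕ (iter ω k i)) (Data.List.upTo n))

cycleType : {n : ℕ} → Vec (Fin n) n → List ℕ
cycleType {n} ω =
  map (cycleLen ω) (filter (λ i → isCycleMin ω i ≟b true) (allFin n))
  where
  open import Data.Bool.Properties using () renaming (_≟_ to _≟b_)

-- λ ⊢ n : a list of positive parts summing to n (order irrelevant)
_⊢_ : List ℕ → ℕ → Set
λs ⊢ n = All (λ p → 1 Data.Nat.≤ p) λs Data.Product.× (sum λs ≡ n)
  where import Data.Product

-- ω ∈ C_λ : cycle type of ω equals λ as a multiset (compare sorted lists)
sortℕ : List ℕ → List ℕ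
sortℕ = SortingAlgorithm.sort mergeSort
  where
  open import Data.Nat.Properties using (≤-decTotalOrder)
  open import Data.List.Sort.MergeSort ≤-decTotalOrder using (mergeSort)
  open import Data.List.Sort.Base using (SortingAlgorithm)

desList : {n : ℕ} → List (Fin n) → ℕ
desList []           = 0
desList (x ∷ [])     = 0
desList (x ∷ y ∷ xs) = (if toℕ y <ᵇ toℕ x then 1 else 0) + desList (y ∷ xs)

des : {n : ℕ} → Vec (Fin n) n → ℕ
des ω = desList (toList ω)

Class : (n : ℕ) → List ℕ → List (Vec (Fin n) n)
Class n λs = filter (λ ω → ≡-dec _≟_ (sortℕ (cycleType ω)) (sortℕ λs)) (Sym n)
  where open import Data.List.Properties using (≡-dec)

-- 𝔼_λ[des] : average of des over the uniform measure on C_λ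
-- (C_λ is nonempty when λ ⊢ n, so the junk value 0 is never used)
expectDes : (n : ℕ) → List ℕ → ℚ
expectDes n λs with length (Class n λs)
... | zero  = Data.Rational.0ℚ
... | suc c = (+ sum (map des (Class n λs))) / suc c

-- Conjugating by the adjacent transposition s = (m  m+1) permutes the conjugacy class C_λ.
-- When every part of λ is at least 3, no ω ∈ C_λ fixes m or swaps m and m + 1, and then
-- exactly one of ω and s ω s has a descent at m.  So each of the n − 1 positions is a descent
-- for exactly half of C_λ, and 2 · Σ_{ω ∈ C_λ} des ω = (n − 1) · |C_λ|.  The class is nonempty:
-- cycling consecutive blocks of lengths λ₁, λ₂, … gives a permutation of cycle type λ.

module Submission where

open import Defs
open import Level using (Level)
open import Data.Nat using (ℕ; zero; suc; _+_; _*_; _∸_; _≤_; _<_; _<ᵇ_; _≤ᵇ_; z≤n; s≤s; z<s; s≤s⁻¹)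
open import Data.Nat.Properties
open import Data.Nat.ListAction using (sum)
open import Data.Nat.GeneralisedArithmetic using (fold)
open import Data.Nat.ListAction.Properties using (sum-↭)
open import Algebra.Properties.CommutativeSemigroup +-commutativeSemigroup using (interchange)
open import Data.Bool using (Bool; true; false; if_then_else_; T)
open import Data.List using (List; []; _∷_; [_]; _++_; map; concatMap; filter; length; allFin; upTo; applyUpTo; tabulate)
open import Data.Bool.ListAction using (and; all)
open import Data.Fin using (Fin; zero; suc; toℕ; fromℕ<)
open import Data.Vec using (Vec; []; _∷_; lookup; toList)
import Data.Vec as Vec
open import Data.Vec.Properties using (lookup-map; lookup∘tabulate)
open import Data.Fin.Properties using (toℕ-injective; toℕ<n; toℕ-fromℕ<; pigeonhole; any?) renaming (_≟_ to _≟ᶠ_)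
open import Data.Bool.Properties using (T-≡; ⇔→≡) renaming (_≟_ to _≟ᵇ_)
open import Data.List.Membership.Propositional.Properties
  using (∈-allFin; ∈-filter⁻; ∈-filter⁺; ∈-map⁺; ∈-upTo⁻; ∈-concatMap⁺)
open import Data.List.Relation.Unary.All using (All; []; _∷_)
import Data.List.Relation.Unary.All as All
open import Data.List.Relation.Unary.All.Properties using (all⁺; all⁻; applyUpTo⁺₁; applyUpTo⁻)
open import Function.Definitions using (Injective)
open import Function.Bundles using (Equivalence; mk⇔)
open import Relation.Nullary.Decidable using (toWitness; fromWitness)
open import Data.Empty using (⊥-elim)
open import Data.Sum using (_⊎_; inj₁; inj₂)
open import Data.Product using (_×_; _,_; proj₁; proj₂; ∃)
open import Data.List.Properties
  using (map-∘; map-id; map-cong; map-cong-local; map-tabulate; tabulate-cong; map-upTo; length-upTo; ≡-dec;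
         concatMap-map; map-concatMap; concatMap-cong; concatMap-++; ++-assoc)
open import Data.List.Membership.Propositional using (_∈_; lose)
open import Data.List.Relation.Unary.Any using (here; there)
open import Data.List.Relation.Binary.Pointwise using (Pointwise-≡⇒≡)
open import Data.List.Relation.Binary.Permutation.Propositional
  using (_↭_; ↭-refl; ↭-sym; ↭-trans; ↭-reflexive; prep; swap; ↭⇒↭ₛ; module PermutationReasoning)
  renaming (refl to ↭-base; trans to ↭-step)
open import Data.List.Relation.Binary.Permutation.Propositional.Properties
  using (map⁺; ++⁺ˡ; ++⁺; shifts; filter-↭; ∈-resp-↭)
import Data.List.Relation.Unary.Sorted.TotalOrder.Properties as Sorted
open import Data.List.Sort.Base using (SortingAlgorithm)
open import Data.List.Sort.MergeSort ≤-decTotalOrder using (mergeSort)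
open SortingAlgorithm mergeSort using (sort-↭)
import Data.Integer.Properties as ℤ
open import Data.Integer using (+_)
open import Data.Rational using (_/_)
open import Data.Rational.Properties using (fromℚᵘ-cong)
open import Data.Rational.Unnormalised using (mkℚᵘ; *≡*)
open import Relation.Nullary using (¬_; does; yes; no)
open import Relation.Unary using (Pred; Decidable)
open import Relation.Binary.PropositionalEquality hiding ([_])
open import Function using (_∘_; id)

private
  variable
    a b c d p : Level
    A : Set a
    B : Set b
    C : Set c
    D : Set d

sum-map-+ : ∀ (xs : List A) (f g : A → ℕ) →
  sum (map (λ x → f x + g x) xs) ≡ sum (map f xs) + sum (map g xs)
sum-map-+ []       f g = refl
sum-map-+ (x ∷ xs) f g = trans (cong (_+_ (f x + g x)) (sum-map-+ xs f g)) (interchange (f x) (g x) _ _)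

sum-map-*ˡ : ∀ (xs : List A) k (f : A → ℕ) → sum (map (λ x → k * f x) xs) ≡ k * sum (map f xs)
sum-map-*ˡ []       k f = sym (*-zeroʳ k)
sum-map-*ˡ (x ∷ xs) k f = trans (cong (_+_ (k * f x)) (sum-map-*ˡ xs k f)) (sym (*-distribˡ-+ k (f x) _))

sum-map-zero : ∀ (xs : List A) → sum (map (λ _ → 0) xs) ≡ 0
sum-map-zero []       = refl
sum-map-zero (x ∷ xs) = sum-map-zero xs

sum-map-const : ∀ (xs : List A) {f : A → ℕ} {k} → (∀ {x} → x ∈ xs → f x ≡ k) → sum (map f xs) ≡ length xs * k
sum-map-const []       fx≡k = refl
sum-map-const (x ∷ xs) fx≡k = cong₂ _+_ (fx≡k (here refl)) (sum-map-const xs (fx≡k ∘ there))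

sum-map-comm : ∀ (xs : List A) (ys : List B) (F : A → B → ℕ) →
  sum (map (λ x → sum (map (F x) ys)) xs) ≡ sum (map (λ y → sum (map (λ x → F x y) xs)) ys)
sum-map-comm []       ys F = sym (sum-map-zero ys)
sum-map-comm (x ∷ xs) ys F =
  trans (cong (_+_ (sum (map (F x) ys))) (sum-map-comm xs ys F)) (sym (sum-map-+ ys (F x) _))

sum-map-↭ : ∀ (f : A → ℕ) {xs ys} → xs ↭ ys → sum (map f xs) ≡ sum (map f ys)
sum-map-↭ f xs↭ys = sum-↭ (map⁺ f xs↭ys)

sum-map-pairing : ∀ (h : A → A) (f : A → ℕ) {k} xs → map h xs ↭ xs →
  (∀ {x} → x ∈ xs → f x + f (h x) ≡ k) → 2 * sum (map f xs) ≡ length xs * k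
sum-map-pairing h f {k} xs hxs↭xs pair = begin
  2 * sum (map f xs)                      ≡⟨ cong (_+_ (sum (map f xs))) (+-identityʳ _) ⟩
  sum (map f xs) + sum (map f xs)         ≡⟨ cong (_+_ (sum (map f xs))) (sum-map-↭ f hxs↭xs) ⟨
  sum (map f xs) + sum (map f (map h xs)) ≡⟨ cong (_+_ (sum (map f xs))) (cong sum (map-∘ xs)) ⟨
  sum (map f xs) + sum (map (f ∘ h) xs)   ≡⟨ sum-map-+ xs f (f ∘ h) ⟨
  sum (map (λ x → f x + f (h x)) xs)      ≡⟨ sum-map-const xs pair ⟩
  length xs * k                           ∎
  where open ≡-Reasoning

concatMap-↭ : ∀ (f : A → List B) {xs ys} → xs ↭ ys → concatMap f xs ↭ concatMap f ys
concatMap-↭ f ↭-base         = ↭-refl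
concatMap-↭ f (prep x p)     = ++⁺ˡ (f x) (concatMap-↭ f p)
concatMap-↭ f (swap x y p)   = ↭-trans (shifts (f x) (f y)) (++⁺ˡ (f y) (++⁺ˡ (f x) (concatMap-↭ f p)))
concatMap-↭ f (↭-step p q)   = ↭-trans (concatMap-↭ f p) (concatMap-↭ f q)

concatMap-cong-↭ : ∀ {f g : A → List B} → (∀ x → f x ↭ g x) → ∀ xs → concatMap f xs ↭ concatMap g xs
concatMap-cong-↭ f↭g []       = ↭-refl
concatMap-cong-↭ f↭g (x ∷ xs) = ++⁺ (f↭g x) (concatMap-cong-↭ f↭g xs)

concatMap-++-↭ : ∀ (f g : A → List B) xs →
  concatMap f xs ++ concatMap g xs ↭ concatMap (λ x → f x ++ g x) xs
concatMap-++-↭ f g []       = ↭-refl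
concatMap-++-↭ f g (x ∷ xs) = begin
  (f x ++ F) ++ g x ++ G   ≡⟨ ++-assoc (f x) F _ ⟩
  f x ++ F ++ g x ++ G     ↭⟨ ++⁺ˡ (f x) (shifts F (g x)) ⟩
  f x ++ g x ++ F ++ G     ↭⟨ ++⁺ˡ (f x) (++⁺ˡ (g x) (concatMap-++-↭ f g xs)) ⟩
  f x ++ g x ++ concatMap (λ x → f x ++ g x) xs ≡⟨ ++-assoc (f x) (g x) _ ⟨
  (f x ++ g x) ++ concatMap (λ x → f x ++ g x) xs ∎
  where
  open PermutationReasoning
  F = concatMap f xs
  G = concatMap g xs

concatMap-[] : ∀ (xs : List A) → concatMap {B = B} (λ _ → []) xs ≡ []
concatMap-[] []       = refl
concatMap-[] (x ∷ xs) = concatMap-[] xs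

concatMap-comm-↭ : ∀ (f : A → B → List C) xs ys →
  concatMap (λ x → concatMap (f x) ys) xs ↭ concatMap (λ y → concatMap (λ x → f x y) xs) ys
concatMap-comm-↭ f []       ys = ↭-reflexive (sym (concatMap-[] ys))
concatMap-comm-↭ f (x ∷ xs) ys =
  ↭-trans (++⁺ˡ (concatMap (f x) ys) (concatMap-comm-↭ f xs ys)) (concatMap-++-↭ (f x) _ ys)

map-concatMap-map : ∀ (g : B → C) (f : A → D → B) (ys : List D) xs →
  map g (concatMap (λ x → map (f x) ys) xs) ≡ concatMap (λ x → map (g ∘ f x) ys) xs
map-concatMap-map g f ys xs =
  trans (map-concatMap g (λ x → map (f x) ys) xs) (concatMap-cong (λ x → sym (map-∘ ys)) xs)

module _ {P : Pred A p} (P? : Decidable P) (h : A → A) where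

  filter-map-comm : ∀ xs → (∀ {x} → x ∈ xs → does (P? (h x)) ≡ does (P? x)) →
    filter P? (map h xs) ≡ map h (filter P? xs)
  filter-map-comm []       inv = refl
  filter-map-comm (x ∷ xs) inv rewrite inv (here refl) with does (P? x)
  ... | true  = cong (h x ∷_) (filter-map-comm xs (inv ∘ there))
  ... | false = filter-map-comm xs (inv ∘ there)

  map-filter-↭ : ∀ {xs} → map h xs ↭ xs → (∀ {x} → x ∈ xs → does (P? (h x)) ≡ does (P? x)) →
    map h (filter P? xs) ↭ filter P? xs
  map-filter-↭ {xs} hxs↭xs inv = ↭-trans (↭-reflexive (sym (filter-map-comm xs inv))) (filter-↭ P? hxs↭xs)

sortℕ-↭ : ∀ {xs ys} → xs ↭ ys → sortℕ xs ≡ sortℕ ys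
sortℕ-↭ {xs} {ys} xs↭ys = Pointwise-≡⇒≡ (Sorted.↗↭↗⇒≋ totalOrder (sort-↗ xs) (sort-↗ ys)
  (↭⇒↭ₛ (↭-trans (sort-↭ xs) (↭-trans xs↭ys (↭-sym (sort-↭ ys))))))
  where
  open SortingAlgorithm mergeSort using (sort-↗)
  open import Relation.Binary.Bundles using (DecTotalOrder)
  totalOrder = DecTotalOrder.totalOrder ≤-decTotalOrder

==⇒≡ : ∀ {n} {i j : Fin n} → (i == j) ≡ true → i ≡ j
==⇒≡ i==j = toℕ-injective (toWitness (Equivalence.from T-≡ i==j))

≡⇒== : ∀ {n} {i j : Fin n} → i ≡ j → (i == j) ≡ true
≡⇒== i≡j = Equivalence.to T-≡ (fromWitness (cong toℕ i≡j))

==-cong : ∀ {n} {i j k l : Fin n} → (i ≡ j → k ≡ l) → (k ≡ l → i ≡ j) → (i == j) ≡ (k == l)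
==-cong to from = ⇔→≡ (mk⇔ (≡⇒== ∘ to ∘ ==⇒≡) (≡⇒== ∘ from ∘ ==⇒≡))

≢⇒==false : ∀ {n} {i j : Fin n} → i ≢ j → (i == j) ≡ false
≢⇒==false {i = i} {j} i≢j with i == j in i==j
... | false = refl
... | true  = ⊥-elim (i≢j (==⇒≡ i==j))

all-upTo-cong : ∀ n {p q : ℕ → Bool} → (∀ {k} → k < n → p k ≡ q k) → all p (upTo n) ≡ all q (upTo n)
all-upTo-cong n pk≡qk = cong and (map-cong-local (applyUpTo⁺₁ id n pk≡qk))

all-upTo-true : ∀ n {p : ℕ → Bool} → (∀ {k} → k < n → T (p k)) → all p (upTo n) ≡ true
all-upTo-true n {p} pk = Equivalence.to T-≡ (all⁻ p (applyUpTo⁺₁ id n pk))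

all-upTo-elim : ∀ n {p : ℕ → Bool} → all p (upTo n) ≡ true → ∀ {k} → k < n → T (p k)
all-upTo-elim n {p} all≡true = applyUpTo⁻ id n (all⁺ p (upTo n) (Equivalence.from T-≡ all≡true))

all-upTo-false : ∀ n {p : ℕ → Bool} {k} → k < n → p k ≡ false → all p (upTo n) ≡ false
all-upTo-false n {p} k<n pk≡false with all p (upTo n) in all≡
... | false = refl
... | true  = ⊥-elim (subst T pk≡false (all-upTo-elim n all≡ k<n))

≤ᵇ-false : ∀ {x y} → y < x → (x ≤ᵇ y) ≡ false
≤ᵇ-false {x} {y} y<x with x ≤ᵇ y in x≤ᵇy
... | false = refl
... | true  = ⊥-elim (<⇒≱ y<x (≤ᵇ⇒≤ x y (Equivalence.from T-≡ x≤ᵇy)))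

𝟙 : Bool → ℕ
𝟙 b = if b then 1 else 0

𝟙-<ᵇ-exclusive : ∀ x y → x ≢ y → 𝟙 (y <ᵇ x) + 𝟙 (x <ᵇ y) ≡ 1
𝟙-<ᵇ-exclusive zero    zero    x≢y = ⊥-elim (x≢y refl)
𝟙-<ᵇ-exclusive zero    (suc y) x≢y = refl
𝟙-<ᵇ-exclusive (suc x) zero    x≢y = refl
𝟙-<ᵇ-exclusive (suc x) (suc y) x≢y = 𝟙-<ᵇ-exclusive x y (x≢y ∘ cong suc)

-- Conjugation by an adjacent transposition

swapℕ : ℕ → ℕ → ℕ
swapℕ zero    zero          = 1
swapℕ zero    (suc zero)    = 0
swapℕ zero    (suc (suc x)) = suc (suc x)
swapℕ (suc m) zero          = zero
swapℕ (suc m) (suc x)       = suc (swapℕ m x)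

swapℕ-left : ∀ m → swapℕ m m ≡ suc m
swapℕ-left zero    = refl
swapℕ-left (suc m) = cong suc (swapℕ-left m)

swapℕ-other : ∀ m x → x ≢ m → x ≢ suc m → swapℕ m x ≡ x
swapℕ-other zero    zero          x≢m x≢1+m = ⊥-elim (x≢m refl)
swapℕ-other zero    (suc zero)    x≢m x≢1+m = ⊥-elim (x≢1+m refl)
swapℕ-other zero    (suc (suc x)) x≢m x≢1+m = refl
swapℕ-other (suc m) zero          x≢m x≢1+m = refl
swapℕ-other (suc m) (suc x)       x≢m x≢1+m = cong suc (swapℕ-other m x (x≢m ∘ cong suc) (x≢1+m ∘ cong suc))

suc-≤ᵇ : ∀ x y → (suc x ≤ᵇ suc y) ≡ (x ≤ᵇ y)
suc-≤ᵇ zero    y = refl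
suc-≤ᵇ (suc x) y = refl

swapℕ-≤ᵇ : ∀ m x y → ¬ (x ≡ m × y ≡ suc m) → ¬ (x ≡ suc m × y ≡ m) →
  (swapℕ m x ≤ᵇ swapℕ m y) ≡ (x ≤ᵇ y)
swapℕ-≤ᵇ zero    zero          zero          _ _ = refl
swapℕ-≤ᵇ zero    zero          (suc zero)    h _ = ⊥-elim (h (refl , refl))
swapℕ-≤ᵇ zero    zero          (suc (suc y)) _ _ = refl
swapℕ-≤ᵇ zero    (suc zero)    zero          _ h = ⊥-elim (h (refl , refl))
swapℕ-≤ᵇ zero    (suc zero)    (suc zero)    _ _ = refl
swapℕ-≤ᵇ zero    (suc zero)    (suc (suc y)) _ _ = refl
swapℕ-≤ᵇ zero    (suc (suc x)) zero          _ _ = refl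
swapℕ-≤ᵇ zero    (suc (suc x)) (suc zero)    _ _ = refl
swapℕ-≤ᵇ zero    (suc (suc x)) (suc (suc y)) _ _ = refl
swapℕ-≤ᵇ (suc m) zero          y             _ _ = refl
swapℕ-≤ᵇ (suc m) (suc x)       zero          _ _ = refl
swapℕ-≤ᵇ (suc m) (suc x)       (suc y)       h h′ =
  trans (suc-≤ᵇ (swapℕ m x) _)
    (trans (swapℕ-≤ᵇ m x y (λ (x≡ , y≡) → h (cong suc x≡ , cong suc y≡))
                           (λ (x≡ , y≡) → h′ (cong suc x≡ , cong suc y≡)))
           (sym (suc-≤ᵇ x y)))

swapℕ-<ᵇ : ∀ m x y → ¬ (x ≡ m × y ≡ suc m) → ¬ (x ≡ suc m × y ≡ m) →
  (swapℕ m x <ᵇ swapℕ m y) ≡ (x <ᵇ y)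
swapℕ-<ᵇ zero    zero          zero          _ _ = refl
swapℕ-<ᵇ zero    zero          (suc zero)    h _ = ⊥-elim (h (refl , refl))
swapℕ-<ᵇ zero    zero          (suc (suc y)) _ _ = refl
swapℕ-<ᵇ zero    (suc zero)    zero          _ h = ⊥-elim (h (refl , refl))
swapℕ-<ᵇ zero    (suc zero)    (suc zero)    _ _ = refl
swapℕ-<ᵇ zero    (suc zero)    (suc (suc y)) _ _ = refl
swapℕ-<ᵇ zero    (suc (suc x)) zero          _ _ = refl
swapℕ-<ᵇ zero    (suc (suc x)) (suc zero)    _ _ = refl
swapℕ-<ᵇ zero    (suc (suc x)) (suc (suc y)) _ _ = refl
swapℕ-<ᵇ (suc m) zero          zero          _ _ = refl
swapℕ-<ᵇ (suc m) zero          (suc y)       _ _ = refl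
swapℕ-<ᵇ (suc m) (suc x)       zero          _ _ = refl
swapℕ-<ᵇ (suc m) (suc x)       (suc y)       h h′ =
  swapℕ-<ᵇ m x y (λ (x≡ , y≡) → h (cong suc x≡ , cong suc y≡))
                 (λ (x≡ , y≡) → h′ (cong suc x≡ , cong suc y≡))

swapℕ-≤ᵇ-left : ∀ m x → (m ≤ᵇ swapℕ m x) ≡ (m ≤ᵇ x)
swapℕ-≤ᵇ-left zero    x       = refl
swapℕ-≤ᵇ-left (suc m) zero    = refl
swapℕ-≤ᵇ-left (suc m) (suc x) = trans (suc-≤ᵇ m (swapℕ m x)) (trans (swapℕ-≤ᵇ-left m x) (sym (suc-≤ᵇ m x)))

-- The transposition (m  m+1) of Fin n; the identity when m + 1 ≥ n.
adjTransp : ∀ {n} → ℕ → Fin n → Fin n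
adjTransp {suc zero}    m       x             = x
adjTransp {suc (suc n)} zero    zero          = suc zero
adjTransp {suc (suc n)} zero    (suc zero)    = zero
adjTransp {suc (suc n)} zero    (suc (suc x)) = suc (suc x)
adjTransp {suc (suc n)} (suc m) zero          = zero
adjTransp {suc (suc n)} (suc m) (suc x)       = suc (adjTransp m x)

adjTransp-involutive : ∀ {n} m (x : Fin n) → adjTransp m (adjTransp m x) ≡ x
adjTransp-involutive {suc zero}    m       x             = refl
adjTransp-involutive {suc (suc n)} zero    zero          = refl
adjTransp-involutive {suc (suc n)} zero    (suc zero)    = refl
adjTransp-involutive {suc (suc n)} zero    (suc (suc x)) = refl
adjTransp-involutive {suc (suc n)} (suc m) zero          = refl
adjTransp-involutive {suc (suc n)} (suc m) (suc x)       = cong suc (adjTransp-involutive m x)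

toℕ-adjTransp : ∀ {n} m (x : Fin n) → suc m < n → toℕ (adjTransp m x) ≡ swapℕ m (toℕ x)
toℕ-adjTransp {suc zero}    m       zero          (s≤s ())
toℕ-adjTransp {suc (suc n)} zero    zero          _             = refl
toℕ-adjTransp {suc (suc n)} zero    (suc zero)    _             = refl
toℕ-adjTransp {suc (suc n)} zero    (suc (suc x)) _             = refl
toℕ-adjTransp {suc (suc n)} (suc m) zero          _             = refl
toℕ-adjTransp {suc (suc n)} (suc m) (suc x)       (s≤s 2+m≤1+n) = cong suc (toℕ-adjTransp m x 2+m≤1+n)

map-adjTransp-allFin-↭ : ∀ n m → map (adjTransp {n} m) (allFin n) ↭ allFin n
map-adjTransp-allFin-↭ zero          m       = ↭-refl
map-adjTransp-allFin-↭ (suc zero)    m       = ↭-refl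
map-adjTransp-allFin-↭ (suc (suc n)) zero    =
  subst (λ xs → suc zero ∷ zero ∷ xs ↭ allFin (suc (suc n)))
        (sym (map-tabulate (λ x → suc (suc x)) (adjTransp zero)))
        (swap (suc zero) zero ↭-refl)
map-adjTransp-allFin-↭ (suc (suc n)) (suc m) =
  prep zero (subst₂ _↭_ shifted (map-tabulate id suc) (map⁺ suc (map-adjTransp-allFin-↭ (suc n) m)))
  where
  shifted : map suc (map (adjTransp m) (allFin (suc n))) ≡ map (adjTransp (suc m)) (tabulate suc)
  shifted = trans (cong (map suc) (map-tabulate id (adjTransp m)))
                  (trans (map-tabulate (adjTransp m) suc) (sym (map-tabulate suc (adjTransp (suc m)))))

swapEntries : ∀ {k} → ℕ → Vec A k → Vec A k
swapEntries zero    (x ∷ y ∷ xs) = y ∷ x ∷ xs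
swapEntries (suc m) (x ∷ xs)     = x ∷ swapEntries m xs
swapEntries _       xs           = xs

lookup-swapEntries : ∀ {n} m (xs : Vec A n) (j : Fin n) → lookup (swapEntries m xs) j ≡ lookup xs (adjTransp m j)
lookup-swapEntries zero    (x ∷ [])     zero          = refl
lookup-swapEntries zero    (x ∷ y ∷ xs) zero          = refl
lookup-swapEntries zero    (x ∷ y ∷ xs) (suc zero)    = refl
lookup-swapEntries zero    (x ∷ y ∷ xs) (suc (suc j)) = refl
lookup-swapEntries (suc m) (x ∷ [])     zero          = refl
lookup-swapEntries (suc m) (x ∷ y ∷ xs) zero          = refl
lookup-swapEntries (suc m) (x ∷ y ∷ xs) (suc j)       = lookup-swapEntries m (y ∷ xs) j

-- In one-line notation, s ∘ ω ∘ s for the transposition s = (m  m+1).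
conjugate : ∀ {n} → ℕ → Vec (Fin n) n → Vec (Fin n) n
conjugate m ω = Vec.map (adjTransp m) (swapEntries m ω)

lookup-conjugate : ∀ {n} m (ω : Vec (Fin n) n) j → lookup (conjugate m ω) j ≡ adjTransp m (lookup ω (adjTransp m j))
lookup-conjugate m ω j =
  trans (lookup-map j (adjTransp m) (swapEntries m ω)) (cong (adjTransp m) (lookup-swapEntries m ω j))

iter-conjugate : ∀ {n} m (ω : Vec (Fin n) n) k j → iter (conjugate m ω) k j ≡ adjTransp m (iter ω k (adjTransp m j))
iter-conjugate m ω zero    j = sym (adjTransp-involutive m j)
iter-conjugate m ω (suc k) j = begin
  lookup (conjugate m ω) (iter (conjugate m ω) k j)
    ≡⟨ cong (lookup (conjugate m ω)) (iter-conjugate m ω k j) ⟩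
  lookup (conjugate m ω) (adjTransp m (iter ω k (adjTransp m j)))
    ≡⟨ lookup-conjugate m ω _ ⟩
  adjTransp m (lookup ω (adjTransp m (adjTransp m (iter ω k (adjTransp m j)))))
    ≡⟨ cong (adjTransp m ∘ lookup ω) (adjTransp-involutive m _) ⟩
  adjTransp m (iter ω (suc k) (adjTransp m j))                 ∎
  where open ≡-Reasoning

allVecs-2+ : ∀ k n →
  allVecs (suc (suc k)) n ≡
  concatMap (λ x → concatMap (λ y → map (λ w → x ∷ y ∷ w) (allVecs k n)) (allFin n)) (allFin n)
allVecs-2+ k n = concatMap-cong (λ x → map-concatMap-map (x ∷_) _∷_ (allVecs k n) (allFin n)) (allFin n)

map-swapEntries-allVecs-↭ : ∀ k n m → map (swapEntries m) (allVecs k n) ↭ allVecs k n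
map-swapEntries-allVecs-↭ zero          n zero    = ↭-refl
map-swapEntries-allVecs-↭ zero          n (suc m) = ↭-refl
map-swapEntries-allVecs-↭ (suc k)       n (suc m) =
  ↭-trans (↭-reflexive (map-concatMap-map (swapEntries (suc m)) _∷_ (allVecs k n) (allFin n)))
          (concatMap-cong-↭ (λ x → ↭-trans (↭-reflexive (map-∘ (allVecs k n)))
                                            (map⁺ (x ∷_) (map-swapEntries-allVecs-↭ k n m)))
                            (allFin n))
map-swapEntries-allVecs-↭ (suc zero)    n zero    =
  ↭-reflexive (trans (map-cong (λ { (x ∷ []) → refl }) (allVecs 1 n)) (map-id (allVecs 1 n)))
map-swapEntries-allVecs-↭ (suc (suc k)) n zero    = begin
  map (swapEntries zero) (allVecs (suc (suc k)) n)
    ≡⟨ cong (map (swapEntries zero)) (allVecs-2+ k n) ⟩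
  map (swapEntries zero) (concatMap (λ x → concatMap (λ y → map (λ w → x ∷ y ∷ w) L) F) F)
    ≡⟨ map-concatMap (swapEntries zero) _ F ⟩
  concatMap (λ x → map (swapEntries zero) (concatMap (λ y → map (λ w → x ∷ y ∷ w) L) F)) F
    ≡⟨ concatMap-cong (λ x → map-concatMap-map (swapEntries zero) (λ y w → x ∷ y ∷ w) L F) F ⟩
  concatMap (λ x → concatMap (λ y → map (λ w → y ∷ x ∷ w) L) F) F
    ↭⟨ concatMap-comm-↭ (λ x y → map (λ w → y ∷ x ∷ w) L) F F ⟩
  concatMap (λ y → concatMap (λ x → map (λ w → y ∷ x ∷ w) L) F) F
    ≡⟨ allVecs-2+ k n ⟨
  allVecs (suc (suc k)) n ∎
  where
  open PermutationReasoning
  F = allFin n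
  L = allVecs k n

map-relabel-allVecs-↭ : ∀ k n (σ : Fin n → Fin n) → map σ (allFin n) ↭ allFin n →
  map (Vec.map σ) (allVecs k n) ↭ allVecs k n
map-relabel-allVecs-↭ zero    n σ σF↭F = ↭-refl
map-relabel-allVecs-↭ (suc k) n σ σF↭F = begin
  map (Vec.map σ) (concatMap (λ x → map (x ∷_) L) F)   ≡⟨ map-concatMap-map (Vec.map σ) _∷_ L F ⟩
  concatMap (λ x → map (λ w → σ x ∷ Vec.map σ w) L) F
    ↭⟨ concatMap-cong-↭ (λ x → ↭-trans (↭-reflexive (map-∘ L)) (map⁺ (σ x ∷_) (map-relabel-allVecs-↭ k n σ σF↭F))) F ⟩
  concatMap (λ x → map (σ x ∷_) L) F                    ≡⟨ concatMap-map (λ y → map (y ∷_) L) σ F ⟨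
  concatMap (λ y → map (y ∷_) L) (map σ F)              ↭⟨ concatMap-↭ (λ y → map (y ∷_) L) σF↭F ⟩
  concatMap (λ y → map (y ∷_) L) F                      ∎
  where
  open PermutationReasoning
  F = allFin n
  L = allVecs k n

map-conjugate-allVecs-↭ : ∀ n m → map (conjugate m) (allVecs n n) ↭ allVecs n n
map-conjugate-allVecs-↭ n m = begin
  map (conjugate m) (allVecs n n)                               ≡⟨ map-∘ (allVecs n n) ⟩
  map (Vec.map (adjTransp m)) (map (swapEntries m) (allVecs n n)) ↭⟨ map⁺ _ (map-swapEntries-allVecs-↭ n n m) ⟩
  map (Vec.map (adjTransp m)) (allVecs n n)
    ↭⟨ map-relabel-allVecs-↭ n n _ (map-adjTransp-allFin-↭ n m) ⟩
  allVecs n n                                                   ∎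
  where open PermutationReasoning

module _ {n} (ω : Vec (Fin n) n) where

  private
    collisionFree : Fin n → Fin n → Bool
    collisionFree i j = if lookup ω i == lookup ω j then i == j else true

  isPerm⇒injective : isPerm ω ≡ true → Injective _≡_ _≡_ (lookup ω)
  isPerm⇒injective perm {i} {j} ωi≡ωj =
    ==⇒≡ (subst (λ b → (if b then i == j else true) ≡ true) (≡⇒== ωi≡ωj) (Equivalence.to T-≡ entry))
    where
    row : T (all (collisionFree i) (allFin n))
    row = All.lookup (all⁺ (λ i → all (collisionFree i) (allFin n)) (allFin n) (Equivalence.from T-≡ perm)) (∈-allFin i)
    entry : T (collisionFree i j)
    entry = All.lookup (all⁺ (collisionFree i) (allFin n) row) (∈-allFin j)

  injective⇒isPerm : Injective _≡_ _≡_ (lookup ω) → isPerm ω ≡ true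
  injective⇒isPerm inj = Equivalence.to T-≡
    (all⁻ (λ i → all (collisionFree i) (allFin n)) {xs = allFin n}
      (All.tabulate λ {i} _ → all⁻ (collisionFree i) {xs = allFin n} (All.tabulate λ {j} _ → entry i j)))
    where
    entry : ∀ i j → T (collisionFree i j)
    entry i j with lookup ω i == lookup ω j in ωi==ωj
    ... | true  = Equivalence.from T-≡ (≡⇒== (inj (==⇒≡ ωi==ωj)))
    ... | false = _

adjTransp-injective : ∀ {n} m {x y : Fin n} → adjTransp m x ≡ adjTransp m y → x ≡ y
adjTransp-injective m {x} {y} eq =
  trans (sym (adjTransp-involutive m x)) (trans (cong (adjTransp m) eq) (adjTransp-involutive m y))

module _ {n} (m : ℕ) {ω : Vec (Fin n) n} where

  conjugate-injective : Injective _≡_ _≡_ (lookup ω) → Injective _≡_ _≡_ (lookup (conjugate m ω))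
  conjugate-injective inj {i} {j} eq = adjTransp-injective m (inj (adjTransp-injective m
    (trans (sym (lookup-conjugate m ω i)) (trans eq (lookup-conjugate m ω j)))))

  conjugate-injective⁻ : Injective _≡_ _≡_ (lookup (conjugate m ω)) → Injective _≡_ _≡_ (lookup ω)
  conjugate-injective⁻ inj {i} {j} eq = adjTransp-injective m (inj (begin
    lookup (conjugate m ω) (adjTransp m i)               ≡⟨ lookup-conjugate m ω _ ⟩
    adjTransp m (lookup ω (adjTransp m (adjTransp m i))) ≡⟨ cong (adjTransp m ∘ lookup ω) (adjTransp-involutive m i) ⟩
    adjTransp m (lookup ω i)                             ≡⟨ cong (adjTransp m) eq ⟩
    adjTransp m (lookup ω j)                             ≡⟨ cong (adjTransp m ∘ lookup ω) (adjTransp-involutive m j) ⟨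
    adjTransp m (lookup ω (adjTransp m (adjTransp m j))) ≡⟨ lookup-conjugate m ω _ ⟨
    lookup (conjugate m ω) (adjTransp m j)               ∎))
    where open ≡-Reasoning

  isPerm-conjugate : isPerm (conjugate m ω) ≡ isPerm ω
  isPerm-conjugate = ⇔→≡ (mk⇔ (injective⇒isPerm ω ∘ conjugate-injective⁻ ∘ isPerm⇒injective (conjugate m ω))
                              (injective⇒isPerm (conjugate m ω) ∘ conjugate-injective ∘ isPerm⇒injective ω))

-- Orbits and cycles

module _ {n} (ω : Vec (Fin n) n) where

  iter-+ : ∀ k j x → iter ω (k + j) x ≡ iter ω k (iter ω j x)
  iter-+ zero    j x = refl
  iter-+ (suc k) j x = cong (lookup ω) (iter-+ k j x)

  iter-comm : ∀ k j x → iter ω k (iter ω j x) ≡ iter ω j (iter ω k x)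
  iter-comm k j x = trans (sym (iter-+ k j x)) (trans (cong (λ i → iter ω i x) (+-comm k j)) (iter-+ j k x))

  iter-mod-period : ∀ {p} x → 0 < p → iter ω p x ≡ x → ∀ k → ∃ λ k′ → k′ < p × iter ω k x ≡ iter ω k′ x
  iter-mod-period x 0<p ωᵖx≡x zero = 0 , 0<p , refl
  iter-mod-period x 0<p ωᵖx≡x (suc k) with iter-mod-period x 0<p ωᵖx≡x k
  ... | k′ , k′<p , eq with m≤n⇒m<n∨m≡n k′<p
  ...   | inj₁ 1+k′<p = suc k′ , 1+k′<p , cong (lookup ω) eq
  ...   | inj₂ 1+k′≡p = 0 , 0<p , trans (cong (lookup ω) eq) (trans (cong (λ i → iter ω i x) 1+k′≡p) ωᵖx≡x)

module _ {n} {ω : Vec (Fin n) n} (inj : Injective _≡_ _≡_ (lookup ω)) where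

  iter-injective : ∀ k {x y} → iter ω k x ≡ iter ω k y → x ≡ y
  iter-injective zero    eq = eq
  iter-injective (suc k) eq = iter-injective k (inj eq)

  iter-period : ∀ x → ∃ λ p → 0 < p × p ≤ n × iter ω p x ≡ x
  iter-period x with pigeonhole (n<1+n n) (λ (i : Fin (suc n)) → iter ω (toℕ i) x)
  ... | i , j , i<j , ωⁱx≡ωʲx =
    toℕ j ∸ toℕ i , m<n⇒0<n∸m i<j , ≤-trans (m∸n≤m (toℕ j) (toℕ i)) (<⇒≤pred (toℕ<n j)) ,
    iter-injective (toℕ i) (begin
      iter ω (toℕ i) (iter ω (toℕ j ∸ toℕ i) x) ≡⟨ iter-+ ω (toℕ i) _ x ⟨
      iter ω (toℕ i + (toℕ j ∸ toℕ i)) x        ≡⟨ cong (λ k → iter ω k x) (m+[n∸m]≡n (<⇒≤ i<j)) ⟩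
      iter ω (toℕ j) x                          ≡⟨ ωⁱx≡ωʲx ⟨
      iter ω (toℕ i) x                          ∎)
    where open ≡-Reasoning

  iter-mod-n : ∀ x k → ∃ λ k′ → k′ < n × iter ω k x ≡ iter ω k′ x
  iter-mod-n x k with iter-period x
  ... | p , 0<p , p≤n , ωᵖx≡x with iter-mod-period ω x 0<p ωᵖx≡x k
  ...   | k′ , k′<p , eq = k′ , <-≤-trans k′<p p≤n , eq

  orbit-sym : ∀ k {x y} → iter ω k x ≡ y → ∃ λ k′ → k′ < n × iter ω k′ y ≡ x
  orbit-sym k {x} ωᵏx≡y with iter-period x
  ... | p , 0<p , p≤n , ωᵖx≡x with iter-mod-period ω x 0<p ωᵖx≡x k
  ...   | r , r<p , ωᵏx≡ωʳx with iter-mod-n _ (p ∸ r)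
  ...     | k′ , k′<n , eq = k′ , k′<n , (begin
    iter ω k′ _                        ≡⟨ eq ⟨
    iter ω (p ∸ r) _                   ≡⟨ cong (iter ω (p ∸ r)) (trans (sym ωᵏx≡y) ωᵏx≡ωʳx) ⟩
    iter ω (p ∸ r) (iter ω r x)        ≡⟨ iter-+ ω (p ∸ r) r x ⟨
    iter ω (p ∸ r + r) x               ≡⟨ cong (λ i → iter ω i x) (m∸n+n≡m (<⇒≤ r<p)) ⟩
    iter ω p x                         ≡⟨ ωᵖx≡x ⟩
    x                                  ∎)
    where open ≡-Reasoning

  orbit-shift : ∀ k₀ {x y} → iter ω k₀ x ≡ y → ∀ k → ∃ λ k′ → k′ < n × iter ω k y ≡ iter ω k′ x
  orbit-shift k₀ {x} ωᵏ⁰x≡y k with iter-mod-n x (k + k₀)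
  ... | k′ , k′<n , eq = k′ , k′<n , trans (cong (iter ω k) (sym ωᵏ⁰x≡y)) (trans (sym (iter-+ ω k k₀ x)) eq)

cycleEntry : ∀ {n} → Vec (Fin n) n → Fin n → List ℕ
cycleEntry ω i = if isCycleMin ω i then [ cycleLen ω i ] else []

map-filter-≡true : ∀ (p : A → Bool) (f : A → B) xs →
  map f (filter (λ x → p x ≟ᵇ true) xs) ≡ concatMap (λ x → if p x then [ f x ] else []) xs
map-filter-≡true p f []       = refl
map-filter-≡true p f (x ∷ xs) with p x
... | true  = cong (f x ∷_) (map-filter-≡true p f xs)
... | false = map-filter-≡true p f xs

cycleType-cycleEntry : ∀ {n} (ω : Vec (Fin n) n) → cycleType ω ≡ concatMap (cycleEntry ω) (allFin n)
cycleType-cycleEntry ω = map-filter-≡true (isCycleMin ω) (cycleLen ω) (allFin _)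

cycleEntry-cong : ∀ {n} (ω ω′ : Vec (Fin n) n) i i′ → isCycleMin ω i ≡ isCycleMin ω′ i′ →
  cycleLen ω i ≡ cycleLen ω′ i′ → cycleEntry ω i ≡ cycleEntry ω′ i′
cycleEntry-cong ω ω′ i i′ = cong₂ (λ b l → if b then [ l ] else [])

cycleEntry-notMin : ∀ {n} (ω : Vec (Fin n) n) i → isCycleMin ω i ≡ false → cycleEntry ω i ≡ []
cycleEntry-notMin ω i notMin rewrite notMin = refl

cycleLen-cong : ∀ {n} {ω ω′ : Vec (Fin n) n} {i i′} → (∀ k → (iter ω k i == i) ≡ (iter ω′ k i′ == i′)) →
  cycleLen ω i ≡ cycleLen ω′ i′
cycleLen-cong {n} {ω} {ω′} {i} {i′} same = cycleLenFrom-cong 1 n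
  where
  cycleLenFrom-cong : ∀ k fuel → cycleLenFrom ω i k fuel ≡ cycleLenFrom ω′ i′ k fuel
  cycleLenFrom-cong k zero = refl
  cycleLenFrom-cong k (suc fuel) rewrite same k with iter ω′ k i′ == i′
  ... | true  = refl
  ... | false = cycleLenFrom-cong (suc k) fuel

cycleLen-conjugate : ∀ {n} m (ω : Vec (Fin n) n) j → cycleLen (conjugate m ω) j ≡ cycleLen ω (adjTransp m j)
cycleLen-conjugate m ω j = cycleLen-cong λ k → ==-cong
  (λ eq → adjTransp-injective m (trans (sym (iter-conjugate m ω k j)) (trans eq (sym (adjTransp-involutive m j)))))
  (λ eq → trans (iter-conjugate m ω k j) (trans (cong (adjTransp m) eq) (adjTransp-involutive m j)))

cycleLen-iter : ∀ {n} {ω : Vec (Fin n) n} → Injective _≡_ _≡_ (lookup ω) → ∀ k i → cycleLen ω (iter ω k i) ≡ cycleLen ω i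
cycleLen-iter {ω = ω} inj k i = cycleLen-cong λ j → ==-cong
  (λ eq → iter-injective inj k (trans (iter-comm ω k j i) eq))
  (λ eq → trans (sym (iter-comm ω k j i)) (cong (iter ω k) eq))

isCycleMin-false : ∀ {n} (ω : Vec (Fin n) n) {i} k → k < n → toℕ (iter ω k i) < toℕ i → isCycleMin ω i ≡ false
isCycleMin-false {n} ω k k<n smaller = all-upTo-false n k<n (≤ᵇ-false smaller)

all-orbit-cong : ∀ {n} {ω : Vec (Fin n) n} → Injective _≡_ _≡_ (lookup ω) → ∀ (q : Fin n → Bool) k₀ {x y} →
  iter ω k₀ x ≡ y → all (λ k → q (iter ω k x)) (upTo n) ≡ all (λ k → q (iter ω k y)) (upTo n)
all-orbit-cong {n} {ω} inj q k₀ x→y with orbit-sym inj k₀ x→y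
... | k₁ , _ , y→x = ⇔→≡ (mk⇔ (transfer k₀ x→y) (transfer k₁ y→x))
  where
  transfer : ∀ k₀ {x y} → iter ω k₀ x ≡ y →
    all (λ k → q (iter ω k x)) (upTo n) ≡ true → all (λ k → q (iter ω k y)) (upTo n) ≡ true
  transfer k₀ x→y all-x = all-upTo-true n λ {k} k<n →
    let k′ , k′<n , eq = orbit-shift inj k₀ x→y k in subst (T ∘ q) (sym eq) (all-upTo-elim n all-x k′<n)

cycleLenFrom-first : ∀ {n} (ω : Vec (Fin n) n) i k d fuel → (∀ j → k ≤ j → j < k + d → iter ω j i ≢ i) →
  iter ω (k + d) i ≡ i → d < fuel → cycleLenFrom ω i k fuel ≡ k + d
cycleLenFrom-first ω i k zero (suc fuel) _ returns _
  rewrite +-identityʳ k | ≡⇒== returns = refl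
cycleLenFrom-first ω i k (suc d) (suc fuel) avoids returns (s≤s d<fuel)
  rewrite ≢⇒==false (avoids k ≤-refl (m<m+n k z<s)) = trans
    (cycleLenFrom-first ω i (suc k) d fuel
      (λ j k<j j<1+k+d → avoids j (<⇒≤ k<j) (subst (j <_) (sym (+-suc k d)) j<1+k+d))
      (subst (λ t → iter ω t i ≡ i) (+-suc k d) returns) d<fuel)
    (sym (+-suc k d))

cycleLen-first : ∀ {n} (ω : Vec (Fin n) n) i d → (∀ j → 0 < j → j ≤ d → iter ω j i ≢ i) →
  iter ω (suc d) i ≡ i → d < n → cycleLen ω i ≡ suc d
cycleLen-first {n} ω i d avoids returns d<n =
  cycleLenFrom-first ω i 1 d n (λ j 0<j j<1+d → avoids j 0<j (s≤s⁻¹ j<1+d)) returns d<n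

module _ {n} (ω : Vec (Fin n) n) where

  iter-fixed : ∀ {i} → lookup ω i ≡ i → ∀ k → iter ω k i ≡ i
  iter-fixed fixed zero    = refl
  iter-fixed fixed (suc k) = trans (cong (lookup ω) (iter-fixed fixed k)) fixed

  fixed-isCycleMin : ∀ {i} → lookup ω i ≡ i → isCycleMin ω i ≡ true
  fixed-isCycleMin {i} fixed = all-upTo-true n λ {k} _ →
    subst (λ x → T (toℕ i ≤ᵇ toℕ x)) (sym (iter-fixed fixed k)) (≤⇒≤ᵇ (≤-refl {toℕ i}))

  fixed-cycleLen : ∀ {i} → lookup ω i ≡ i → cycleLen ω i ≡ 1
  fixed-cycleLen {i} fixed = cycleLen-first ω i 0 (λ { zero () }) fixed (≤-<-trans z≤n (toℕ<n i))

  swapped-isCycleMin : ∀ {i j} → toℕ i ≤ toℕ j → lookup ω i ≡ j → lookup ω j ≡ i → isCycleMin ω i ≡ true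
  swapped-isCycleMin {i} {j} i≤j ωi≡j ωj≡i = all-upTo-true n λ {k} _ → bounded k
    where
    iterates : ∀ k → iter ω k i ≡ i ⊎ iter ω k i ≡ j
    iterates zero = inj₁ refl
    iterates (suc k) with iterates k
    ... | inj₁ ωᵏi≡i = inj₂ (trans (cong (lookup ω) ωᵏi≡i) ωi≡j)
    ... | inj₂ ωᵏi≡j = inj₁ (trans (cong (lookup ω) ωᵏi≡j) ωj≡i)
    bounded : ∀ k → T (toℕ i ≤ᵇ toℕ (iter ω k i))
    bounded k with iterates k
    ... | inj₁ ωᵏi≡i = subst (λ x → T (toℕ i ≤ᵇ toℕ x)) (sym ωᵏi≡i) (≤⇒≤ᵇ (≤-refl {toℕ i}))
    ... | inj₂ ωᵏi≡j = subst (λ x → T (toℕ i ≤ᵇ toℕ x)) (sym ωᵏi≡j) (≤⇒≤ᵇ i≤j)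

  swapped-cycleLen : ∀ {i j} → toℕ i < toℕ j → lookup ω i ≡ j → lookup ω j ≡ i → cycleLen ω i ≡ 2
  swapped-cycleLen {i} {j} i<j ωi≡j ωj≡i = cycleLen-first ω i 1
    (λ { (suc zero) _ _ ωi≡i → <-irrefl (cong toℕ (trans (sym ωi≡i) ωi≡j)) i<j
       ; (suc (suc _)) _ (s≤s ()) })
    (trans (cong (lookup ω) ωi≡j) ωj≡i)
    (≤-<-trans (≤-trans (s≤s z≤n) i<j) (toℕ<n j))

descentAt : ∀ {n k} → ℕ → Vec (Fin n) k → ℕ
descentAt zero    (x ∷ y ∷ _) = 𝟙 (toℕ y <ᵇ toℕ x)
descentAt (suc m) (_ ∷ xs)    = descentAt m xs
descentAt _       _           = 0

desList-descentAt : ∀ {n k} (v : Vec (Fin n) k) → desList (toList v) ≡ sum (applyUpTo (λ m → descentAt m v) (k ∸ 1))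
desList-descentAt []           = refl
desList-descentAt (x ∷ [])     = refl
desList-descentAt (x ∷ y ∷ xs) = cong (_+_ (𝟙 (toℕ y <ᵇ toℕ x))) (desList-descentAt (y ∷ xs))

des-descentAt : ∀ {n} (ω : Vec (Fin n) n) → des ω ≡ sum (map (λ m → descentAt m ω) (upTo (n ∸ 1)))
des-descentAt {n} ω = trans (desList-descentAt ω) (cong sum (sym (map-upTo _ (n ∸ 1))))

descentAt-lookup : ∀ {n k} m (v : Vec (Fin n) k) i j → toℕ i ≡ m → toℕ j ≡ suc m →
  descentAt m v ≡ 𝟙 (toℕ (lookup v j) <ᵇ toℕ (lookup v i))
descentAt-lookup zero    (x ∷ y ∷ xs) zero    (suc zero) refl refl = refl
descentAt-lookup (suc m) (x ∷ xs)     (suc i) (suc j)    i≡m  j≡1+m =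
  descentAt-lookup m xs i j (suc-injective i≡m) (suc-injective j≡1+m)

module AdjacentConjugation {n} (m : ℕ) (1+m<n : suc m < n) {ω : Vec (Fin n) n}
                           (inj : Injective _≡_ _≡_ (lookup ω)) where

  private
    s : Fin n → Fin n
    s = adjTransp m

    w : Vec (Fin n) n
    w = conjugate m ω

    toℕ-s : ∀ x → toℕ (s x) ≡ swapℕ m (toℕ x)
    toℕ-s x = toℕ-adjTransp m x 1+m<n

    toℕ-≡ : ∀ {x y : Fin n} {t} → toℕ x ≡ t → toℕ y ≡ t → x ≡ y
    toℕ-≡ x≡t y≡t = toℕ-injective (trans x≡t (sym y≡t))

  p₀ p₁ : Fin n
  p₀ = fromℕ< (<-trans (n<1+n m) 1+m<n)
  p₁ = fromℕ< 1+m<n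

  toℕ-p₀ : toℕ p₀ ≡ m
  toℕ-p₀ = toℕ-fromℕ< _

  toℕ-p₁ : toℕ p₁ ≡ suc m
  toℕ-p₁ = toℕ-fromℕ< _

  p₀<p₁ : toℕ p₀ < toℕ p₁
  p₀<p₁ = subst₂ _<_ (sym toℕ-p₀) (sym toℕ-p₁) (n<1+n m)

  s-p₀ : s p₀ ≡ p₁
  s-p₀ = toℕ-≡ (trans (toℕ-s p₀) (trans (cong (swapℕ m) toℕ-p₀) (swapℕ-left m))) toℕ-p₁

  s-p₁ : s p₁ ≡ p₀
  s-p₁ = trans (cong s (sym s-p₀)) (adjTransp-involutive m p₀)

  s-other : ∀ j → j ≢ p₀ → j ≢ p₁ → s j ≡ j
  s-other j j≢p₀ j≢p₁ = toℕ-injective (trans (toℕ-s j)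
    (swapℕ-other m (toℕ j) (j≢p₀ ∘ λ j≡m → toℕ-≡ j≡m toℕ-p₀) (j≢p₁ ∘ λ j≡1+m → toℕ-≡ j≡1+m toℕ-p₁)))

  -- Whether m and m + 1 lie in one cycle of ω decides how the cycle minima move under conjugation.
  Linked : Set
  Linked = ∃ λ k → k < n × iter ω k p₀ ≡ p₁

  cycleEntry-conjugate : ∀ j → (∀ {k} → k < n → ¬ (s j ≡ p₀ × iter ω k (s j) ≡ p₁)) →
    (∀ {k} → k < n → ¬ (s j ≡ p₁ × iter ω k (s j) ≡ p₀)) → cycleEntry w j ≡ cycleEntry ω (s j)
  cycleEntry-conjugate j not₀₁ not₁₀ = cycleEntry-cong w ω j (s j) isCycleMin-w (cycleLen-conjugate m ω j)
    where
    isCycleMin-w : isCycleMin w j ≡ isCycleMin ω (s j)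
    isCycleMin-w = all-upTo-cong n λ {k} k<n → begin
      toℕ j ≤ᵇ toℕ (iter w k j)
        ≡⟨ cong₂ _≤ᵇ_ (trans (cong toℕ (sym (adjTransp-involutive m j))) (toℕ-s (s j)))
                      (trans (cong toℕ (iter-conjugate m ω k j)) (toℕ-s _)) ⟩
      swapℕ m (toℕ (s j)) ≤ᵇ swapℕ m (toℕ (iter ω k (s j)))
        ≡⟨ swapℕ-≤ᵇ m _ _ (λ (sj≡m , ωᵏsj≡1+m) → not₀₁ k<n (toℕ-≡ sj≡m toℕ-p₀ , toℕ-≡ ωᵏsj≡1+m toℕ-p₁))
                          (λ (sj≡1+m , ωᵏsj≡m) → not₁₀ k<n (toℕ-≡ sj≡1+m toℕ-p₁ , toℕ-≡ ωᵏsj≡m toℕ-p₀)) ⟩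
      toℕ (s j) ≤ᵇ toℕ (iter ω k (s j))
        ∎
      where open ≡-Reasoning

  cycleEntry-conjugate-unlinked : ¬ Linked → ∀ j → cycleEntry w j ≡ cycleEntry ω (s j)
  cycleEntry-conjugate-unlinked unlinked j = cycleEntry-conjugate j
    (λ {k} k<n (sj≡p₀ , ωᵏsj≡p₁) → unlinked (k , k<n , subst (λ x → iter ω k x ≡ p₁) sj≡p₀ ωᵏsj≡p₁))
    (λ {k} k<n (sj≡p₁ , ωᵏsj≡p₀) → unlinked (orbit-sym inj k (subst (λ x → iter ω k x ≡ p₀) sj≡p₁ ωᵏsj≡p₀)))

  isCycleMin-conjugate-p₀ : Linked → isCycleMin w p₀ ≡ isCycleMin ω p₀
  isCycleMin-conjugate-p₀ (k₀ , _ , p₀→p₁) = begin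
    all (λ k → toℕ p₀ ≤ᵇ toℕ (iter w k p₀)) (upTo n)
      ≡⟨ all-upTo-cong n (λ {k} _ → cong₂ _≤ᵇ_ toℕ-p₀ (begin
           toℕ (iter w k p₀)                    ≡⟨ cong toℕ (iter-conjugate m ω k p₀) ⟩
           toℕ (s (iter ω k (s p₀)))             ≡⟨ toℕ-s _ ⟩
           swapℕ m (toℕ (iter ω k (s p₀)))       ≡⟨ cong (λ x → swapℕ m (toℕ (iter ω k x))) s-p₀ ⟩
           swapℕ m (toℕ (iter ω k p₁))           ∎)) ⟩
    all (λ k → m ≤ᵇ swapℕ m (toℕ (iter ω k p₁))) (upTo n)
      ≡⟨ all-upTo-cong n (λ _ → swapℕ-≤ᵇ-left m _) ⟩
    all (λ k → m ≤ᵇ toℕ (iter ω k p₁)) (upTo n)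
      ≡⟨ all-orbit-cong inj (λ x → m ≤ᵇ toℕ x) k₀ p₀→p₁ ⟨
    all (λ k → m ≤ᵇ toℕ (iter ω k p₀)) (upTo n)
      ≡⟨ cong (λ t → all (λ k → t ≤ᵇ toℕ (iter ω k p₀)) (upTo n)) toℕ-p₀ ⟨
    all (λ k → toℕ p₀ ≤ᵇ toℕ (iter ω k p₀)) (upTo n)
      ∎
    where open ≡-Reasoning

  cycleLen-conjugate-p₀ : Linked → cycleLen w p₀ ≡ cycleLen ω p₀
  cycleLen-conjugate-p₀ (k₀ , _ , p₀→p₁) = begin
    cycleLen w p₀              ≡⟨ cycleLen-conjugate m ω p₀ ⟩
    cycleLen ω (s p₀)          ≡⟨ cong (cycleLen ω) (trans s-p₀ (sym p₀→p₁)) ⟩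
    cycleLen ω (iter ω k₀ p₀)  ≡⟨ cycleLen-iter inj k₀ p₀ ⟩
    cycleLen ω p₀              ∎
    where open ≡-Reasoning

  isCycleMin-conjugate-p₁ : Linked → isCycleMin w p₁ ≡ false
  isCycleMin-conjugate-p₁ (k₀ , k₀<n , p₀→p₁) =
    isCycleMin-false w k₀ k₀<n (subst (λ x → toℕ x < toℕ p₁) (sym w-p₁→p₀) p₀<p₁)
    where
    w-p₁→p₀ : iter w k₀ p₁ ≡ p₀
    w-p₁→p₀ = trans (iter-conjugate m ω k₀ p₁) (trans (cong (s ∘ iter ω k₀) s-p₁) (trans (cong s p₀→p₁) s-p₁))

  isCycleMin-p₁ : Linked → isCycleMin ω p₁ ≡ false
  isCycleMin-p₁ (k₀ , _ , p₀→p₁) with orbit-sym inj k₀ p₀→p₁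
  ... | k₁ , k₁<n , p₁→p₀ = isCycleMin-false ω k₁ k₁<n (subst (λ x → toℕ x < toℕ p₁) (sym p₁→p₀) p₀<p₁)

  cycleEntry-conjugate-linked : Linked → ∀ j → cycleEntry w j ≡ cycleEntry ω j
  cycleEntry-conjugate-linked linked j with j ≟ᶠ p₀ | j ≟ᶠ p₁
  ... | yes refl | _        = cycleEntry-cong w ω p₀ p₀ (isCycleMin-conjugate-p₀ linked) (cycleLen-conjugate-p₀ linked)
  ... | no _     | yes refl =
    trans (cycleEntry-notMin w p₁ (isCycleMin-conjugate-p₁ linked))
          (sym (cycleEntry-notMin ω p₁ (isCycleMin-p₁ linked)))
  ... | no j≢p₀  | no j≢p₁  = trans (cycleEntry-conjugate j (λ _ (sj≡p₀ , _) → j≢p₀ (trans (sym sj≡j) sj≡p₀))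
                                                        (λ _ (sj≡p₁ , _) → j≢p₁ (trans (sym sj≡j) sj≡p₁)))
                                    (cong (cycleEntry ω) sj≡j)
    where
    sj≡j : s j ≡ j
    sj≡j = s-other j j≢p₀ j≢p₁

  cycleType-conjugate-↭ : cycleType w ↭ cycleType ω
  cycleType-conjugate-↭ with any? (λ (k : Fin n) → iter ω (toℕ k) p₀ ≟ᶠ p₁)
  ... | yes (k , p₀→p₁) = ↭-reflexive (begin
    cycleType w                          ≡⟨ cycleType-cycleEntry w ⟩
    concatMap (cycleEntry w) (allFin n)
      ≡⟨ concatMap-cong (cycleEntry-conjugate-linked (toℕ k , toℕ<n k , p₀→p₁)) (allFin n) ⟩
    concatMap (cycleEntry ω) (allFin n)  ≡⟨ cycleType-cycleEntry ω ⟨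
    cycleType ω                          ∎)
    where open ≡-Reasoning
  ... | no unlinked = begin
    cycleType w                                  ≡⟨ cycleType-cycleEntry w ⟩
    concatMap (cycleEntry w) (allFin n)
      ≡⟨ concatMap-cong (cycleEntry-conjugate-unlinked unlinked′) (allFin n) ⟩
    concatMap (cycleEntry ω ∘ s) (allFin n)      ≡⟨ concatMap-map (cycleEntry ω) s (allFin n) ⟨
    concatMap (cycleEntry ω) (map s (allFin n))  ↭⟨ concatMap-↭ (cycleEntry ω) (map-adjTransp-allFin-↭ n m) ⟩
    concatMap (cycleEntry ω) (allFin n)          ≡⟨ cycleType-cycleEntry ω ⟨
    cycleType ω                                  ∎
    where
    open PermutationReasoning
    unlinked′ : ¬ Linked
    unlinked′ (k , k<n , p₀→p₁) =
      unlinked (fromℕ< k<n , subst (λ i → iter ω i p₀ ≡ p₁) (sym (toℕ-fromℕ< k<n)) p₀→p₁)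

  descentAt-conjugate : lookup ω p₀ ≢ p₀ → ¬ (lookup ω p₀ ≡ p₁ × lookup ω p₁ ≡ p₀) →
    descentAt m ω + descentAt m w ≡ 1
  descentAt-conjugate not-fixed not-swapped = begin
    descentAt m ω + descentAt m w
      ≡⟨ cong₂ _+_ (descentAt-lookup m ω p₀ p₁ toℕ-p₀ toℕ-p₁) (descentAt-lookup m w p₀ p₁ toℕ-p₀ toℕ-p₁) ⟩
    𝟙 (x₁ <ᵇ x₀) + 𝟙 (toℕ (lookup w p₁) <ᵇ toℕ (lookup w p₀))
      ≡⟨ cong (λ t → 𝟙 (x₁ <ᵇ x₀) + 𝟙 t) (cong₂ _<ᵇ_ (w-at p₁ p₀ s-p₁) (w-at p₀ p₁ s-p₀)) ⟩
    𝟙 (x₁ <ᵇ x₀) + 𝟙 (swapℕ m x₀ <ᵇ swapℕ m x₁)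
      ≡⟨ cong (λ t → 𝟙 (x₁ <ᵇ x₀) + 𝟙 t) (swapℕ-<ᵇ m x₀ x₁
           (λ (x₀≡m , _) → not-fixed (toℕ-≡ x₀≡m toℕ-p₀))
           (λ (x₀≡1+m , x₁≡m) → not-swapped (toℕ-≡ x₀≡1+m toℕ-p₁ , toℕ-≡ x₁≡m toℕ-p₀))) ⟩
    𝟙 (x₁ <ᵇ x₀) + 𝟙 (x₀ <ᵇ x₁)
      ≡⟨ 𝟙-<ᵇ-exclusive x₀ x₁ (λ x₀≡x₁ → p₀≢p₁ (inj (toℕ-injective x₀≡x₁))) ⟩
    1 ∎
    where
    open ≡-Reasoning
    x₀ = toℕ (lookup ω p₀)
    x₁ = toℕ (lookup ω p₁)
    p₀≢p₁ : p₀ ≢ p₁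
    p₀≢p₁ p₀≡p₁ = <-irrefl (cong toℕ p₀≡p₁) p₀<p₁
    w-at : ∀ i j → s i ≡ j → toℕ (lookup w i) ≡ swapℕ m (toℕ (lookup ω j))
    w-at i j si≡j = trans (cong toℕ (trans (lookup-conjugate m ω i) (cong (s ∘ lookup ω) si≡j))) (toℕ-s _)

-- Averaging over a conjugacy class

module _ (λs : List ℕ) (parts≥3 : All (3 ≤_) λs) {n} {ω : Vec (Fin n) n}
         (ω-type : sortℕ (cycleType ω) ≡ sortℕ λs) where

  cycleLen-part : ∀ {i} → isCycleMin ω i ≡ true → 3 ≤ cycleLen ω i
  cycleLen-part {i} isMin = All.lookup parts≥3 (∈-resp-↭ (sort-↭ λs)
    (subst (cycleLen ω i ∈_) ω-type (∈-resp-↭ (↭-sym (sort-↭ (cycleType ω)))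
      (∈-map⁺ (cycleLen ω) (∈-filter⁺ (λ j → isCycleMin ω j ≟ᵇ true) (∈-allFin i) isMin)))))

  no-fixed-point : ∀ i → lookup ω i ≢ i
  no-fixed-point i fixed =
    <⇒≱ (s≤s (s≤s z≤n)) (subst (3 ≤_) (fixed-cycleLen ω fixed) (cycleLen-part (fixed-isCycleMin ω fixed)))

  no-2-cycle : ∀ {i j} → toℕ i < toℕ j → lookup ω i ≡ j → lookup ω j ≢ i
  no-2-cycle i<j ωi≡j ωj≡i = <⇒≱ ≤-refl
    (subst (3 ≤_) (swapped-cycleLen ω i<j ωi≡j ωj≡i) (cycleLen-part (swapped-isCycleMin ω (<⇒≤ i<j) ωi≡j ωj≡i)))

Sym-injective : ∀ {n} {ω : Vec (Fin n) n} → ω ∈ Sym n → Injective _≡_ _≡_ (lookup ω)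
Sym-injective {n} {ω} ω∈Sym = isPerm⇒injective ω (proj₂ (∈-filter⁻ (λ ω → isPerm ω ≟ᵇ true) {xs = allVecs n n} ω∈Sym))

conjugate-Class-↭ : ∀ n λs m → suc m < n → map (conjugate m) (Class n λs) ↭ Class n λs
conjugate-Class-↭ n λs m 1+m<n =
  map-filter-↭ (λ ω → ≡-dec _≟_ (sortℕ (cycleType ω)) (sortℕ λs)) (conjugate m)
    (map-filter-↭ (λ ω → isPerm ω ≟ᵇ true) (conjugate m) (map-conjugate-allVecs-↭ n m)
      (λ {ω} _ → cong (λ b → does (b ≟ᵇ true)) (isPerm-conjugate m {ω})))
    (λ {ω} ω∈Sym → cong (λ xs → does (≡-dec _≟_ xs (sortℕ λs))) (sortℕ-↭
      (AdjacentConjugation.cycleType-conjugate-↭ m 1+m<n {ω} (Sym-injective ω∈Sym))))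

module _ (n : ℕ) (λs : List ℕ) (parts≥3 : All (3 ≤_) λs) where

  private
    𝒞 : List (Vec (Fin n) n)
    𝒞 = Class n λs

  descentAt-paired : ∀ m → suc m < n → ∀ {ω} → ω ∈ 𝒞 → descentAt m ω + descentAt m (conjugate m ω) ≡ 1
  descentAt-paired m 1+m<n {ω} ω∈𝒞 with ∈-filter⁻ (λ ω → ≡-dec _≟_ (sortℕ (cycleType ω)) (sortℕ λs)) ω∈𝒞
  ... | ω∈Sym , ω-type = descentAt-conjugate (no-fixed-point λs parts≥3 ω-type p₀)
    (λ (ωp₀≡p₁ , ωp₁≡p₀) → no-2-cycle λs parts≥3 ω-type p₀<p₁ ωp₀≡p₁ ωp₁≡p₀)
    where open AdjacentConjugation m 1+m<n {ω} (Sym-injective ω∈Sym)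

  double-sum-descentAt : ∀ m → suc m < n → 2 * sum (map (descentAt m) 𝒞) ≡ length 𝒞
  double-sum-descentAt m 1+m<n = trans
    (sum-map-pairing (conjugate m) (descentAt m) 𝒞 (conjugate-Class-↭ n λs m 1+m<n) (descentAt-paired m 1+m<n))
    (*-identityʳ _)

  double-sum-des : 2 * sum (map des 𝒞) ≡ (n ∸ 1) * length 𝒞
  double-sum-des = begin
    2 * sum (map des 𝒞)                                         ≡⟨ cong (λ xs → 2 * sum xs) (map-cong des-descentAt 𝒞) ⟩
    2 * sum (map (λ ω → sum (map (λ m → descentAt m ω) ms)) 𝒞)  ≡⟨ cong (2 *_) (sum-map-comm 𝒞 ms _) ⟩
    2 * sum (map (λ m → sum (map (descentAt m) 𝒞)) ms)          ≡⟨ sum-map-*ˡ ms 2 _ ⟨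
    sum (map (λ m → 2 * sum (map (descentAt m) 𝒞)) ms)
      ≡⟨ sum-map-const ms (λ m∈ms → double-sum-descentAt _ (pred-cancel-< (∈-upTo⁻ m∈ms))) ⟩
    length ms * length 𝒞                                        ≡⟨ cong (_* length 𝒞) (length-upTo (n ∸ 1)) ⟩
    (n ∸ 1) * length 𝒞                                          ∎
    where
    open ≡-Reasoning
    ms = upTo (n ∸ 1)

cross-mult⇒/≡ : ∀ x y c d → x * suc d ≡ y * suc c → (+ x) / suc c ≡ (+ y) / suc d
cross-mult⇒/≡ x y c d eq = fromℚᵘ-cong {mkℚᵘ (+ x) c} {mkℚᵘ (+ y) d}
  (*≡* (trans (sym (ℤ.pos-* x (suc d))) (trans (cong +_ eq) (ℤ.pos-* y (suc c)))))

expectDes-from-double-sum : ∀ n λs k → 2 * sum (map des (Class n λs)) ≡ k * length (Class n λs) →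
  0 < length (Class n λs) → expectDes n λs ≡ (+ k) / 2
expectDes-from-double-sum n λs k double-sum nonempty with length (Class n λs)
... | zero  = ⊥-elim (<-irrefl refl nonempty)
... | suc c = cross-mult⇒/≡ S k c 1 (trans (*-comm S 2) double-sum)
  where S = sum (map des (Class n λs))

-- A permutation of every cycle type

range : ℕ → ℕ → List ℕ
range a zero    = []
range a (suc k) = a ∷ range (suc a) k

range-++ : ∀ a k j → range a (k + j) ≡ range a k ++ range (a + k) j
range-++ a zero    j = cong (λ b → range b j) (sym (+-identityʳ a))
range-++ a (suc k) j =
  cong (a ∷_) (trans (range-++ (suc a) k j) (cong (λ b → range (suc a) k ++ range b j) (sym (+-suc a k))))

tabulate-range : ∀ a k → tabulate {n = k} (λ i → a + toℕ i) ≡ range a k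
tabulate-range a zero    = refl
tabulate-range a (suc k) =
  cong₂ _∷_ (+-identityʳ a) (trans (tabulate-cong (λ i → +-suc a (toℕ i))) (tabulate-range (suc a) k))

map-toℕ-allFin : ∀ n → map toℕ (allFin n) ≡ range 0 n
map-toℕ-allFin n = trans (map-tabulate id toℕ) (tabulate-range 0 n)

concatMap-range-cong : ∀ {E E′ : ℕ → List A} a k → (∀ {x} → a ≤ x → x < a + k → E x ≡ E′ x) →
  concatMap E (range a k) ≡ concatMap E′ (range a k)
concatMap-range-cong a zero    E≡E′ = refl
concatMap-range-cong a (suc k) E≡E′ = cong₂ _++_ (E≡E′ ≤-refl (m<m+n a z<s))
  (concatMap-range-cong (suc a) k (λ {x} a<x x<1+a+k → E≡E′ (<⇒≤ a<x) (subst (x <_) (sym (+-suc a k)) x<1+a+k)))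

blockShift : ℕ → ℕ → ℕ → ℕ
blockShift a l x with suc x <? a + l
... | yes _ = suc x
... | no  _ = a

blockShift-step : ∀ a l {x} → suc x < a + l → blockShift a l x ≡ suc x
blockShift-step a l {x} 1+x<a+l with suc x <? a + l
... | yes _     = refl
... | no  1+x≮ = ⊥-elim (1+x≮ 1+x<a+l)

blockShift-wrap : ∀ a l {x} → suc x ≡ a + l → blockShift a l x ≡ a
blockShift-wrap a l {x} 1+x≡a+l with suc x <? a + l
... | yes 1+x<a+l = ⊥-elim (<-irrefl 1+x≡a+l 1+x<a+l)
... | no  _       = refl

blockShift-inside : ∀ {a l x} → a ≤ x → x < a + l → a ≤ blockShift a l x × blockShift a l x < a + l
blockShift-inside {a} {l} {x} a≤x x<a+l with suc x <? a + l
... | yes 1+x<a+l = m≤n⇒m≤1+n a≤x , 1+x<a+l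
... | no  _       = ≤-refl , ≤-<-trans a≤x x<a+l

blockShift-injective : ∀ {a l x y} → a ≤ x → x < a + l → a ≤ y → y < a + l → blockShift a l x ≡ blockShift a l y → x ≡ y
blockShift-injective {a} {l} {x} {y} a≤x x<a+l a≤y y<a+l eq with suc x <? a + l | suc y <? a + l
... | yes _   | yes _   = suc-injective eq
... | yes _   | no  _   = ⊥-elim (<-irrefl (sym eq) (s≤s a≤x))
... | no  _   | yes _   = ⊥-elim (<-irrefl eq (s≤s a≤y))
... | no  1+x≮ | no 1+y≮ = suc-injective (trans (≤-antisym x<a+l (≮⇒≥ 1+x≮)) (sym (≤-antisym y<a+l (≮⇒≥ 1+y≮))))

-- The permutation of [a, a + sum ls) that cycles consecutive blocks of lengths ls.
blocksPerm : List ℕ → ℕ → ℕ → ℕ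
blocksPerm []       a x = x
blocksPerm (l ∷ ls) a x with x <? a + l
... | yes _ = blockShift a l x
... | no  _ = blocksPerm ls (a + l) x

blocksPerm-here : ∀ l ls a {x} → x < a + l → blocksPerm (l ∷ ls) a x ≡ blockShift a l x
blocksPerm-here l ls a {x} x<a+l with x <? a + l
... | yes _    = refl
... | no  x≮ = ⊥-elim (x≮ x<a+l)

blocksPerm-there : ∀ l ls a {x} → a + l ≤ x → blocksPerm (l ∷ ls) a x ≡ blocksPerm ls (a + l) x
blocksPerm-there l ls a {x} a+l≤x with x <? a + l
... | yes x<a+l = ⊥-elim (<⇒≱ x<a+l a+l≤x)
... | no  _     = refl

blocksPerm-≥ : ∀ ls a {x} → a ≤ x → a ≤ blocksPerm ls a x
blocksPerm-≥ []       a a≤x = a≤x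
blocksPerm-≥ (l ∷ ls) a {x} a≤x with x <? a + l
... | yes x<a+l = proj₁ (blockShift-inside a≤x x<a+l)
... | no  x≮   = ≤-trans (m≤m+n a l) (blocksPerm-≥ ls (a + l) (≮⇒≥ x≮))

blocksPerm-< : ∀ ls a {x} → a ≤ x → x < a + sum ls → blocksPerm ls a x < a + sum ls
blocksPerm-< []       a a≤x x< = x<
blocksPerm-< (l ∷ ls) a {x} a≤x x< with x <? a + l
... | yes x<a+l = <-≤-trans (proj₂ (blockShift-inside a≤x x<a+l)) (+-monoʳ-≤ a (m≤m+n l (sum ls)))
... | no  x≮   = subst (blocksPerm ls (a + l) x <_) (+-assoc a l (sum ls))
  (blocksPerm-< ls (a + l) (≮⇒≥ x≮) (subst (x <_) (sym (+-assoc a l (sum ls))) x<))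

blocksPerm-injective : ∀ ls a {x y} → a ≤ x → a ≤ y → blocksPerm ls a x ≡ blocksPerm ls a y → x ≡ y
blocksPerm-injective []       a a≤x a≤y eq = eq
blocksPerm-injective (l ∷ ls) a {x} {y} a≤x a≤y eq with x <? a + l | y <? a + l
... | yes x<a+l | yes y<a+l = blockShift-injective a≤x x<a+l a≤y y<a+l eq
... | yes x<a+l | no  y≮   =
  ⊥-elim (<⇒≱ (proj₂ (blockShift-inside a≤x x<a+l)) (subst (a + l ≤_) (sym eq) (blocksPerm-≥ ls (a + l) (≮⇒≥ y≮))))
... | no  x≮   | yes y<a+l =
  ⊥-elim (<⇒≱ (proj₂ (blockShift-inside a≤y y<a+l)) (subst (a + l ≤_) eq (blocksPerm-≥ ls (a + l) (≮⇒≥ x≮))))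
... | no  x≮   | no  y≮   = blocksPerm-injective ls (a + l) (≮⇒≥ x≮) (≮⇒≥ y≮) eq

-- What cycleEntry records at x for the permutation blocksPerm ls a.
blockEntry : List ℕ → ℕ → ℕ → List ℕ
blockEntry []       a x = []
blockEntry (l ∷ ls) a x with x <? a + l | x ≟ a
... | yes _ | yes _ = [ l ]
... | yes _ | no  _ = []
... | no  _ | _     = blockEntry ls (a + l) x

concatMap-blockEntry : ∀ ls a → All (1 ≤_) ls → concatMap (blockEntry ls a) (range a (sum ls)) ≡ ls
concatMap-blockEntry []              a []                = refl
concatMap-blockEntry (suc l′ ∷ ls) a (s≤s z≤n ∷ pos) = begin
  concatMap E (range a (l + sum ls))                               ≡⟨ cong (concatMap E) (range-++ a l (sum ls)) ⟩
  concatMap E (range a l ++ range (a + l) (sum ls))                ≡⟨ concatMap-++ E (range a l) _ ⟩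
  (E a ++ concatMap E (range (suc a) l′)) ++ concatMap E (range (a + l) (sum ls))
    ≡⟨ cong₂ (λ xs ys → (xs ++ ys) ++ concatMap E (range (a + l) (sum ls))) start
         (trans (concatMap-range-cong (suc a) l′ inner) (concatMap-[] (range (suc a) l′))) ⟩
  l ∷ concatMap E (range (a + l) (sum ls))
    ≡⟨ cong (l ∷_) (concatMap-range-cong (a + l) (sum ls) later) ⟩
  l ∷ concatMap (blockEntry ls (a + l)) (range (a + l) (sum ls))
    ≡⟨ cong (l ∷_) (concatMap-blockEntry ls (a + l) pos) ⟩
  l ∷ ls                                                           ∎
  where
  open ≡-Reasoning
  l = suc l′
  E = blockEntry (l ∷ ls) a
  start : E a ≡ [ l ]
  start with a <? a + l | a ≟ a
  ... | yes _ | yes _   = refl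
  ... | yes _ | no  a≢a = ⊥-elim (a≢a refl)
  ... | no  a≮ | _      = ⊥-elim (a≮ (m<m+n a z<s))
  inner : ∀ {x} → suc a ≤ x → x < suc a + l′ → E x ≡ []
  inner {x} a<x x< with x <? a + l | x ≟ a
  ... | yes _ | yes x≡a = ⊥-elim (<-irrefl (sym x≡a) a<x)
  ... | yes _ | no  _   = refl
  ... | no  x≮ | _      = ⊥-elim (x≮ (subst (x <_) (sym (+-suc a l′)) x<))
  later : ∀ {x} → a + l ≤ x → x < a + l + sum ls → E x ≡ blockEntry ls (a + l) x
  later {x} a+l≤x _ with x <? a + l | x ≟ a
  ... | yes x<a+l | _ = ⊥-elim (<⇒≱ x<a+l a+l≤x)
  ... | no  _     | _ = refl

-- fold x f k is the iterate fᵏ x.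
module Block (f : ℕ → ℕ) {a l : ℕ} (f-block : ∀ {x} → a ≤ x → x < a + l → f x ≡ blockShift a l x) where

  fold-inside : ∀ k {x} → a ≤ x → x < a + l → a ≤ fold x f k × fold x f k < a + l
  fold-inside zero    a≤x x<a+l = a≤x , x<a+l
  fold-inside (suc k) a≤x x<a+l with fold-inside k a≤x x<a+l
  ... | a≤y , y<a+l = subst (λ z → a ≤ z × z < a + l) (sym (f-block a≤y y<a+l)) (blockShift-inside a≤y y<a+l)

  fold-walk : ∀ j {x} → a ≤ x → x + j < a + l → fold x f j ≡ x + j
  fold-walk zero    {x} _   _        = sym (+-identityʳ x)
  fold-walk (suc j) {x} a≤x x+1+j< = begin
    f (fold x f j)          ≡⟨ cong f (fold-walk j a≤x x+j<) ⟩
    f (x + j)               ≡⟨ f-block (≤-trans a≤x (m≤m+n x j)) x+j< ⟩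
    blockShift a l (x + j)  ≡⟨ blockShift-step a l (subst (_< a + l) (+-suc x j) x+1+j<) ⟩
    suc (x + j)             ≡⟨ +-suc x j ⟨
    x + suc j               ∎
    where
    open ≡-Reasoning
    x+j< : x + j < a + l
    x+j< = <-trans (+-monoʳ-< x (n<1+n j)) x+1+j<

  fold-wrap : ∀ j {x} → a ≤ x → x + suc j ≡ a + l → fold x f (suc j) ≡ a
  fold-wrap j {x} a≤x x+1+j≡ = begin
    f (fold x f j)          ≡⟨ cong f (fold-walk j a≤x x+j<) ⟩
    f (x + j)               ≡⟨ f-block (≤-trans a≤x (m≤m+n x j)) x+j< ⟩
    blockShift a l (x + j)  ≡⟨ blockShift-wrap a l (trans (sym (+-suc x j)) x+1+j≡) ⟩
    a                       ∎
    where
    open ≡-Reasoning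
    x+j< : x + j < a + l
    x+j< = subst (x + j <_) x+1+j≡ (+-monoʳ-< x (n<1+n j))

module _ {n} (ω : Vec (Fin n) n) (f : ℕ → ℕ) (toℕ-lookup : ∀ i → toℕ (lookup ω i) ≡ f (toℕ i)) where

  toℕ-iter : ∀ k i → toℕ (iter ω k i) ≡ fold (toℕ i) f k
  toℕ-iter zero    i = refl
  toℕ-iter (suc k) i = trans (toℕ-lookup _) (cong f (toℕ-iter k i))

  cycleEntry-blockStart : ∀ {a l′} → (∀ {x} → a ≤ x → x < a + suc l′ → f x ≡ blockShift a (suc l′) x) →
    a + suc l′ ≤ n → ∀ {i} → toℕ i ≡ a → cycleEntry ω i ≡ [ suc l′ ]
  cycleEntry-blockStart {a} {l′} f-block a+l≤n {i} i≡a = cong₂ (λ b l → if b then [ l ] else []) isMin length-l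
    where
    open Block f f-block
    a≤i : a ≤ toℕ i
    a≤i = ≤-reflexive (sym i≡a)
    i<a+l : toℕ i < a + suc l′
    i<a+l = subst (_< a + suc l′) (sym i≡a) (m<m+n a z<s)
    isMin : isCycleMin ω i ≡ true
    isMin = all-upTo-true n λ {k} _ →
      ≤⇒≤ᵇ (subst₂ _≤_ (sym i≡a) (sym (toℕ-iter k i)) (proj₁ (fold-inside k a≤i i<a+l)))
    length-l : cycleLen ω i ≡ suc l′
    length-l = cycleLen-first ω i l′
      (λ j 0<j j≤l′ ωʲi≡i → <-irrefl (sym
        (trans (sym (fold-walk j a≤i (subst (λ t → t + j < a + suc l′) (sym i≡a) (+-monoʳ-< a (s≤s j≤l′)))))
               (trans (sym (toℕ-iter j i)) (cong toℕ ωʲi≡i))))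
        (m<m+n (toℕ i) 0<j))
      (toℕ-injective (trans (toℕ-iter (suc l′) i) (trans (fold-wrap l′ a≤i (cong (_+ suc l′) i≡a)) (sym i≡a))))
      (<-≤-trans (n<1+n l′) (≤-trans (m≤n+m (suc l′) a) a+l≤n))

  cycleEntry-blockInner : ∀ {a l} → (∀ {x} → a ≤ x → x < a + l → f x ≡ blockShift a l x) →
    a + l ≤ n → ∀ {i} → a < toℕ i → toℕ i < a + l → cycleEntry ω i ≡ []
  cycleEntry-blockInner {a} {l} f-block a+l≤n {i} a<i i<a+l = cycleEntry-notMin ω i
    (isCycleMin-false ω (suc r) 1+r<n (subst (_< toℕ i) (sym returns-to-a) a<i))
    where
    open Block f f-block
    r = a + l ∸ suc (toℕ i)
    i+1+r≡a+l : toℕ i + suc r ≡ a + l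
    i+1+r≡a+l = trans (+-suc (toℕ i) r) (m+[n∸m]≡n i<a+l)
    returns-to-a : toℕ (iter ω (suc r) i) ≡ a
    returns-to-a = trans (toℕ-iter (suc r) i) (fold-wrap r (<⇒≤ a<i) i+1+r≡a+l)
    1+r<n : suc r < n
    1+r<n = <-≤-trans (+-cancelˡ-< a (suc r) l (subst (a + suc r <_) i+1+r≡a+l (+-monoˡ-< (suc r) a<i)))
                      (≤-trans (m≤n+m l a) a+l≤n)

  cycleEntry-blocks : ∀ ls a → All (1 ≤_) ls → a + sum ls ≤ n → (∀ {x} → a ≤ x → f x ≡ blocksPerm ls a x) →
    ∀ i → a ≤ toℕ i → toℕ i < a + sum ls → cycleEntry ω i ≡ blockEntry ls a (toℕ i)
  cycleEntry-blocks []             a []              _ _ i a≤i i<a+0 =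
    ⊥-elim (<⇒≱ i<a+0 (subst (_≤ toℕ i) (sym (+-identityʳ a)) a≤i))
  cycleEntry-blocks (suc l′ ∷ ls) a (s≤s z≤n ∷ pos) bound f≡blocksPerm i a≤i i<a+Σ with toℕ i <? a + suc l′ | toℕ i ≟ a
  ... | yes _     | yes i≡a = cycleEntry-blockStart f-block block-bound i≡a
    where
    f-block : ∀ {x} → a ≤ x → x < a + suc l′ → f x ≡ blockShift a (suc l′) x
    f-block a≤x x< = trans (f≡blocksPerm a≤x) (blocksPerm-here (suc l′) ls a x<)
    block-bound : a + suc l′ ≤ n
    block-bound = ≤-trans (+-monoʳ-≤ a (m≤m+n (suc l′) (sum ls))) bound
  ... | yes i<a+l | no  i≢a = cycleEntry-blockInner f-block block-bound (≤∧≢⇒< a≤i (i≢a ∘ sym)) i<a+l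
    where
    f-block : ∀ {x} → a ≤ x → x < a + suc l′ → f x ≡ blockShift a (suc l′) x
    f-block a≤x x< = trans (f≡blocksPerm a≤x) (blocksPerm-here (suc l′) ls a x<)
    block-bound : a + suc l′ ≤ n
    block-bound = ≤-trans (+-monoʳ-≤ a (m≤m+n (suc l′) (sum ls))) bound
  ... | no  i≮   | _ = cycleEntry-blocks ls (a + suc l′) pos
    (subst (_≤ n) (sym (+-assoc a (suc l′) (sum ls))) bound)
    (λ a+l≤x → trans (f≡blocksPerm (≤-trans (m≤m+n a (suc l′)) a+l≤x)) (blocksPerm-there (suc l′) ls a a+l≤x))
    i (≮⇒≥ i≮) (subst (toℕ i <_) (sym (+-assoc a (suc l′) (sum ls))) i<a+Σ)

∈-allVecs : ∀ k n (v : Vec (Fin n) k) → v ∈ allVecs k n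
∈-allVecs zero    n []      = here refl
∈-allVecs (suc k) n (x ∷ v) =
  ∈-concatMap⁺ (λ y → map (y ∷_) (allVecs k n)) (lose (∈-allFin x) (∈-map⁺ (x ∷_) (∈-allVecs k n v)))

module _ (λs : List ℕ) (positive : All (1 ≤_) λs) where

  private
    n : ℕ
    n = sum λs

    f : ℕ → ℕ
    f = blocksPerm λs 0

  blocksVec : Vec (Fin n) n
  blocksVec = Vec.tabulate (λ i → fromℕ< (blocksPerm-< λs 0 z≤n (toℕ<n i)))

  toℕ-lookup-blocksVec : ∀ i → toℕ (lookup blocksVec i) ≡ f (toℕ i)
  toℕ-lookup-blocksVec i = trans (cong toℕ (lookup∘tabulate _ i)) (toℕ-fromℕ< _)

  blocksVec-injective : Injective _≡_ _≡_ (lookup blocksVec)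
  blocksVec-injective {i} {j} eq = toℕ-injective (blocksPerm-injective λs 0 z≤n z≤n
    (trans (sym (toℕ-lookup-blocksVec i)) (trans (cong toℕ eq) (toℕ-lookup-blocksVec j))))

  cycleType-blocksVec : cycleType blocksVec ≡ λs
  cycleType-blocksVec = begin
    cycleType blocksVec                                  ≡⟨ cycleType-cycleEntry blocksVec ⟩
    concatMap (cycleEntry blocksVec) (allFin n)
      ≡⟨ concatMap-cong (λ i → cycleEntry-blocks blocksVec f toℕ-lookup-blocksVec λs 0 positive ≤-refl (λ _ → refl)
                                                 i z≤n (toℕ<n i)) (allFin n) ⟩
    concatMap (blockEntry λs 0 ∘ toℕ) (allFin n)         ≡⟨ concatMap-map (blockEntry λs 0) toℕ (allFin n) ⟨
    concatMap (blockEntry λs 0) (map toℕ (allFin n))     ≡⟨ cong (concatMap (blockEntry λs 0)) (map-toℕ-allFin n) ⟩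
    concatMap (blockEntry λs 0) (range 0 n)              ≡⟨ concatMap-blockEntry λs 0 positive ⟩
    λs                                                   ∎
    where open ≡-Reasoning

  blocksVec-∈-Class : blocksVec ∈ Class n λs
  blocksVec-∈-Class = ∈-filter⁺ (λ ω → ≡-dec _≟_ (sortℕ (cycleType ω)) (sortℕ λs))
    (∈-filter⁺ (λ ω → isPerm ω ≟ᵇ true) (∈-allVecs n n blocksVec) (injective⇒isPerm blocksVec blocksVec-injective))
    (cong sortℕ cycleType-blocksVec)

  Class-nonempty : 0 < length (Class n λs)
  Class-nonempty with Class n λs | blocksVec-∈-Class
  ... | _ ∷ _ | _ = z<s

corollary3p6 : (n : ℕ) (λs : List ℕ) → λs ⊢ n → All (λ p → 3 ≤ p) λs →
    expectDes n λs ≡ (+ (n ∸ 1)) / 2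
corollary3p6 .(sum λs) λs (positive , refl) parts≥3 =
  expectDes-from-double-sum (sum λs) λs (sum λs ∸ 1) (double-sum-des (sum λs) λs parts≥3) (Class-nonempty λs positive)
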